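{- For every positive integer $n$, $F_2(n)\le F^{\mathrm{weak}}(n)$.
   Context: For a positive integer $n$, $[n]=\{1,\dots,n\}$ and $[n]^{(2)}$ is the set of $2$-element subsets of $[n]$. For positive integers $n,r$, $\mathcal{C}_{n;r}$ is the set of all maps $c:[n]^{(2)}\to[r]$ (edge-colorings of the complete graph on vertex set $[n]$). For such $c$, a twin of size $\ell$ is a pair of disjoint sets $I=\{i_1<\dots<i_\ell\}$, $J=\{j_1<\dots<j_\ell\}\subset[n]$ with $c(\{i_t,i_{t+1}\})=c(\{j_t,j_{t+1}\})$ for all $t=1,\dots,\ell-1$. Let $f(c)$ be the maximum $\ell$ such that $c$ has a twin of size $\ell$, and $F_r(n)=\min_{c\in\mathcal{C}_{n;r}} f(c)$. For a permutation $\pi\in S_n$, a weak-twin of $\pi$ is a pair of disjoint sets $I=\{i_1<\dots<i_\ell\}$, $J=\{j_1<\dots<j_\ell\}\subset[n]$ such that for each $t\in[\ell-1]$, $\pi(i_t)<\pi(i_{t+1})$ if and only if $\pi(j_t)<\pi(j_{t+1})$. Let $f^{\mathrm{weak}}(\pi)$ be the largest $\ell$ such that $\pi$ has a weak-twin with $|I|=\ell$, and $F^{\mathrm{weak}}(n)=\min_{\pi\in S_n} f^{\mathrm{weak}}(\pi)$. -}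

module Defs where

open import Data.Nat using (ℕ; suc; _≤_)
open import Data.Fin using (Fin; toℕ; _<_)
open import Data.Fin.Permutation using (Permutation′; _⟨$⟩ʳ_)
open import Data.Product using (Σ; _×_)
open import Relation.Binary.PropositionalEquality using (_≡_; _≢_)

-- Vertex set [n] is represented by Fin n (0-based, same order).
-- An r-edge-colouring of K_n: c i j is the colour of the edge {i,j}; only the
-- values with i < j are ever consulted (the edge {i,j} is read as c i j, i < j).
Colouring : ℕ → ℕ → Set
Colouring n r = Fin n → Fin n → Fin r

StrictlyIncreasing : ∀ {ℓ n} → (Fin ℓ → Fin n) → Set
StrictlyIncreasing {ℓ} I = (s t : Fin ℓ) → s < t → I s < I t

Disjoint : ∀ {ℓ n} → (Fin ℓ → Fin n) → (Fin ℓ → Fin n) → Set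
Disjoint {ℓ} I J = (s t : Fin ℓ) → I s ≢ J t

Consecutive : ∀ {ℓ} → Fin ℓ → Fin ℓ → Set
Consecutive s t = toℕ t ≡ suc (toℕ s)

IsTwin : ∀ {n r} → Colouring n r → (ℓ : ℕ) → (Fin ℓ → Fin n) → (Fin ℓ → Fin n) → Set
IsTwin {n} c ℓ I J =
  StrictlyIncreasing I × StrictlyIncreasing J × Disjoint I J ×
  ((s t : Fin ℓ) → Consecutive s t → c (I s) (I t) ≡ c (J s) (J t))

HasTwin : ∀ {n r} → Colouring n r → ℕ → Set
HasTwin {n} c ℓ = Σ (Fin ℓ → Fin n) λ I → Σ (Fin ℓ → Fin n) λ J → IsTwin c ℓ I J

IsF : ∀ {n r} → Colouring n r → ℕ → Set
IsF c m = HasTwin c m × ((ℓ : ℕ) → HasTwin c ℓ → ℓ ≤ m)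

IsFr : ℕ → ℕ → ℕ → Set
IsFr r n m = Σ (Colouring n r) (λ c → IsF c m) ×
             ((c : Colouring n r) (k : ℕ) → IsF c k → m ≤ k)

IsWeakTwin : ∀ {n} → Permutation′ n → (ℓ : ℕ) → (Fin ℓ → Fin n) → (Fin ℓ → Fin n) → Set
IsWeakTwin {n} π ℓ I J =
  StrictlyIncreasing I × StrictlyIncreasing J × Disjoint I J ×
  ((s t : Fin ℓ) → Consecutive s t →
     ((π ⟨$⟩ʳ I s < π ⟨$⟩ʳ I t → π ⟨$⟩ʳ J s < π ⟨$⟩ʳ J t) ×
      (π ⟨$⟩ʳ J s < π ⟨$⟩ʳ J t → π ⟨$⟩ʳ I s < π ⟨$⟩ʳ I t)))

HasWeakTwin : ∀ {n} → Permutation′ n → ℕ → Set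
HasWeakTwin {n} π ℓ = Σ (Fin ℓ → Fin n) λ I → Σ (Fin ℓ → Fin n) λ J → IsWeakTwin π ℓ I J

IsFweak : ∀ {n} → Permutation′ n → ℕ → Set
IsFweak π m = HasWeakTwin π m × ((ℓ : ℕ) → HasWeakTwin π ℓ → ℓ ≤ m)

IsFWeak : ℕ → ℕ → Set
IsFWeak n m = Σ (Permutation′ n) (λ π → IsFweak π m) ×
              ((π : Permutation′ n) (k : ℕ) → IsFweak π k → m ≤ k)

{-# OPTIONS --safe #-}
-- A permutation π determines the 2-colouring c_π of K_n that colours {i < j} by whether
-- π ascends from i to j. The weak-twins of π are exactly the twins of c_π, so
-- f^weak(π) = f(c_π), and the minimum F_2(n) of f over all 2-colourings is at most the
-- minimum F^weak(n) over colourings of this special form. Constructively one must also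
-- show that these maxima and minima exist; they do because every quantifier involved
-- ranges over a finite set and can be decided by exhaustive search.
module Submission where

open import Defs
open import Data.Nat using (ℕ; _≤_)
open import Data.Product using (Σ; _×_)

open import Level using (0ℓ)
open import Data.Nat as ℕ using (zero; suc; _+_)
import Data.Nat.Properties as ℕ
open import Data.Fin as Fin using (Fin; toℕ)
open import Data.Fin.Properties using (any?; all?; _<?_; _≟_; <-cmp; <-irrefl; injective⇒≤)
open import Data.Fin.Permutation
  using (Permutation′; _⟨$⟩ʳ_; _⟨$⟩ˡ_; permutation; inverseˡ; inverseʳ)
import Data.Fin.Permutation as Permutation
open import Data.Vec.Functional using (Vector; []; _∷_; head; tail)
open import Data.Vec.Functional.Relation.Binary.Pointwise using (Pointwise)
open import Data.Product using (∃; _,_; proj₁; proj₂)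
open import Data.Sum using (inj₁; inj₂)
open import Relation.Nullary using (Dec; yes; no; ¬_; contradiction)
open import Relation.Nullary.Decidable using (map′; _×-dec_; _→-dec_; ¬?)
open import Relation.Unary using (Pred; Decidable)
open import Relation.Binary using (Rel; Reflexive; _Respects_; tri<; tri≈; tri>)
open import Relation.Binary.PropositionalEquality
open import Function using (_∘_)

Exhaustible : (A : Set) → Rel A 0ℓ → Set₁
Exhaustible A _≈_ = ∀ {P : Pred A 0ℓ} → P Respects _≈_ → Decidable P → Dec (∃ P)

Fin-exhaustible : ∀ {n} → Exhaustible (Fin n) _≡_
Fin-exhaustible _ P? = any? P?

Vector-exhaustible : ∀ {A _≈_} → Reflexive _≈_ → Exhaustible A _≈_ →
                     ∀ k → Exhaustible (Vector A k) (Pointwise _≈_)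
Vector-exhaustible ≈-refl search zero resp P? =
  map′ (λ p → [] , p) (λ (v , p) → resp (λ ()) p) (P? [])
Vector-exhaustible {_≈_ = _≈_} ≈-refl search (suc k) {P} resp P? =
  map′ (λ (x , xs , p) → x ∷ xs , p) (λ (v , p) → head v , tail v , resp (η v) p) ∃-head?
  where
  η : ∀ v → Pointwise _≈_ v (head v ∷ tail v)
  η v Fin.zero = ≈-refl
  η v (Fin.suc i) = ≈-refl

  ∃-head? : Dec (∃ λ x → ∃ λ xs → P (x ∷ xs))
  ∃-head? = search
    (λ x≈y (xs , p) → xs , resp (λ { Fin.zero → x≈y ; (Fin.suc i) → ≈-refl }) p)
    (λ x → Vector-exhaustible ≈-refl search k
      (λ xs≈ys → resp (λ { Fin.zero → ≈-refl ; (Fin.suc i) → xs≈ys i }))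
      (λ xs → P? (x ∷ xs)))

Function-exhaustible : ∀ {m n} → Exhaustible (Fin m → Fin n) (Pointwise _≡_)
Function-exhaustible = Vector-exhaustible refl Fin-exhaustible _

Colouring-exhaustible : ∀ {n r} → Exhaustible (Colouring n r) (Pointwise (Pointwise _≡_))
Colouring-exhaustible = Vector-exhaustible (λ _ → refl) Function-exhaustible _

_≈ₚ_ : ∀ {n} → Rel (Permutation′ n) 0ℓ
π ≈ₚ ρ = Pointwise _≡_ (π ⟨$⟩ʳ_) (ρ ⟨$⟩ʳ_)

Inverses : ∀ {n} → (Fin n → Fin n) → (Fin n → Fin n) → Set
Inverses f g = (∀ y → f (g y) ≡ y) × (∀ x → g (f x) ≡ x)

inverses? : ∀ {n} (f g : Fin n → Fin n) → Dec (Inverses f g)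
inverses? f g = all? (λ y → f (g y) ≟ y) ×-dec all? (λ x → g (f x) ≟ x)

Inverses-respects : ∀ {n} {f f′ g g′ : Fin n → Fin n} →
                    Pointwise _≡_ f f′ → Pointwise _≡_ g g′ → Inverses f g → Inverses f′ g′
Inverses-respects {f = f} {f′} {g} {g′} f≗f′ g≗g′ (fg , gf) =
  (λ y → trans (sym (f≗f′ (g′ y))) (trans (cong f (sym (g≗g′ y))) (fg y))) ,
  (λ x → trans (sym (g≗g′ (f′ x))) (trans (cong g (sym (f≗f′ x))) (gf x)))

toPermutation : ∀ {n} (f g : Fin n → Fin n) → Inverses f g → Permutation′ n
toPermutation f g (fg , gf) = permutation f g fg gf

Permutation-inverses : ∀ {n} (π : Permutation′ n) → Inverses (π ⟨$⟩ʳ_) (π ⟨$⟩ˡ_)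
Permutation-inverses π = (λ _ → inverseʳ π) , (λ _ → inverseˡ π)

Permutation-exhaustible : ∀ {n} → Exhaustible (Permutation′ n) _≈ₚ_
Permutation-exhaustible {n} {P} resp P? =
  map′ (λ (f , g , inv , p) → toPermutation f g inv , p)
       (λ (π , p) → (π ⟨$⟩ʳ_) , (π ⟨$⟩ˡ_) , Permutation-inverses π , resp (λ _ → refl) p)
       (Function-exhaustible
         (λ f≗f′ (g , inv , p) → g , Inverses-respects f≗f′ (λ _ → refl) inv , resp f≗f′ p)
         (λ f → Function-exhaustible
           (λ g≗g′ (inv , p) → Inverses-respects (λ _ → refl) g≗g′ inv , resp (λ _ → refl) p)
           (P-on-inverses? f)))
  where
  P-on-inverses? : (f g : Fin n → Fin n) → Dec (Σ (Inverses f g) (P ∘ toPermutation f g))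
  P-on-inverses? f g with inverses? f g
  ... | yes inv = map′ (inv ,_) (resp (λ _ → refl) ∘ proj₂) (P? (toPermutation f g inv))
  ... | no ¬inv = no (¬inv ∘ proj₁)

IsGreatest : Pred ℕ 0ℓ → ℕ → Set
IsGreatest P m = P m × (∀ ℓ → P ℓ → ℓ ≤ m)

IsLeast : Pred ℕ 0ℓ → ℕ → Set
IsLeast P m = P m × (∀ ℓ → P ℓ → m ≤ ℓ)

module _ {P : Pred ℕ 0ℓ} (P? : Decidable P) where

  greatest : P 0 → ∀ k → (∀ ℓ → P ℓ → ℓ ≤ k) → ∃ (IsGreatest P)
  greatest p₀ zero ≤0 = 0 , p₀ , ≤0
  greatest p₀ (suc k) ≤k+1 with P? (suc k)
  ... | yes p = suc k , p , ≤k+1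
  ... | no ¬p = greatest p₀ k λ ℓ pℓ →
    ℕ.≤-pred (ℕ.≤∧≢⇒< (≤k+1 ℓ pℓ) λ { refl → ¬p pℓ })

  leastFrom : ∀ d i → (∀ j → j ℕ.< i → ¬ P j) → P (d + i) → ∃ (IsLeast P)
  leastFrom d i ¬P<i pd+i with P? i
  ... | yes p = i , p , λ j pj → ℕ.≮⇒≥ λ j<i → ¬P<i j j<i pj
  leastFrom zero i ¬P<i pi | no ¬p = contradiction pi ¬p
  leastFrom (suc d) i ¬P<i pd+i | no ¬p =
    leastFrom d (suc i) ¬P<i+1 (subst P (sym (ℕ.+-suc d i)) pd+i)
    where
    ¬P<i+1 : ∀ j → j ℕ.< suc i → ¬ P j
    ¬P<i+1 j j<i+1 with ℕ.m<1+n⇒m<n∨m≡n j<i+1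
    ... | inj₁ j<i = ¬P<i j j<i
    ... | inj₂ refl = ¬p

  least : ∀ {k} → P k → ∃ (IsLeast P)
  least {k} pk = leastFrom k 0 (λ _ ()) (subst P (sym (ℕ.+-identityʳ k)) pk)

isGreatest? : ∀ {P} → ∃ (IsGreatest P) → Decidable (IsGreatest P)
isGreatest? (k , pk , ≤k) m with m ℕ.≟ k
... | yes refl = yes (pk , ≤k)
... | no m≢k = no λ (pm , ≤m) → m≢k (ℕ.≤-antisym (≤k m pm) (≤m k pk))

leastValue : ∀ {X : Set} {_≈_ : Rel X 0ℓ} → Exhaustible X _≈_ →
             (V : X → ℕ → Set) → (∀ {m} → (λ x → V x m) Respects _≈_) →
             (∀ x → Decidable (V x)) → (x₀ : X) → ∀ {m₀} → V x₀ m₀ →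
             ∃ λ a → Σ X (λ x → V x a) × (∀ x k → V x k → a ≤ k)
leastValue search V resp V? x₀ vx₀ with least (λ m → search resp (λ x → V? x m)) (x₀ , vx₀)
... | a , va , a≤ = a , va , λ x k vx → a≤ k (x , vx)

module _ {ℓ n : ℕ} where

  strictlyIncreasing? : (I : Fin ℓ → Fin n) → Dec (StrictlyIncreasing I)
  strictlyIncreasing? I = all? λ s → all? λ t → (s <? t) →-dec (I s <? I t)

  disjoint? : (I J : Fin ℓ → Fin n) → Dec (Disjoint I J)
  disjoint? I J = all? λ s → all? λ t → ¬? (I s ≟ J t)

  strictlyIncreasing⇒injective : {I : Fin ℓ → Fin n} → StrictlyIncreasing I →
                                 ∀ {s t} → I s ≡ I t → s ≡ t
  strictlyIncreasing⇒injective {I} inc {s} {t} Is≡It with <-cmp s t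
  ... | tri< s<t _ _ = contradiction (inc s t s<t) (<-irrefl Is≡It)
  ... | tri≈ _ s≡t _ = s≡t
  ... | tri> _ _ t<s = contradiction (inc t s t<s) (<-irrefl (sym Is≡It))

module _ {n r : ℕ} (c : Colouring n r) where

  isTwin? : ∀ ℓ I J → Dec (IsTwin c ℓ I J)
  isTwin? ℓ I J =
    strictlyIncreasing? I ×-dec strictlyIncreasing? J ×-dec disjoint? I J ×-dec
    (all? λ s → all? λ t → (toℕ t ℕ.≟ suc (toℕ s)) →-dec (c (I s) (I t) ≟ c (J s) (J t)))

  IsTwin-respects : ∀ {ℓ I I′ J J′} → Pointwise _≡_ I I′ → Pointwise _≡_ J J′ →
                    IsTwin c ℓ I J → IsTwin c ℓ I′ J′
  IsTwin-respects I≗I′ J≗J′ (incI , incJ , disj , same) =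
    (λ s t s<t → subst₂ Fin._<_ (I≗I′ s) (I≗I′ t) (incI s t s<t)) ,
    (λ s t s<t → subst₂ Fin._<_ (J≗J′ s) (J≗J′ t) (incJ s t s<t)) ,
    (λ s t I′s≡J′t → disj s t (trans (I≗I′ s) (trans I′s≡J′t (sym (J≗J′ t))))) ,
    (λ s t st → trans (cong₂ c (sym (I≗I′ s)) (sym (I≗I′ t)))
                  (trans (same s t st) (cong₂ c (J≗J′ s) (J≗J′ t))))

  hasTwin? : Decidable (HasTwin c)
  hasTwin? ℓ = Function-exhaustible
    (λ I≗I′ (J , twin) → J , IsTwin-respects I≗I′ (λ _ → refl) twin)
    (λ I → Function-exhaustible (IsTwin-respects (λ _ → refl)) (isTwin? ℓ I))

  emptyTwin : HasTwin c 0
  emptyTwin = (λ ()) , (λ ()) , (λ ()) , (λ ()) , (λ ()) , λ ()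

  HasTwin⇒≤ : ∀ {ℓ} → HasTwin c ℓ → ℓ ≤ n
  HasTwin⇒≤ (I , J , incI , _) = injective⇒≤ (strictlyIncreasing⇒injective incI)

  f-exists : ∃ (IsF c)
  f-exists = greatest hasTwin? emptyTwin n λ _ → HasTwin⇒≤

  isF? : Decidable (IsF c)
  isF? = isGreatest? f-exists

HasTwin-respects : ∀ {n r ℓ} {c c′ : Colouring n r} →
                   Pointwise (Pointwise _≡_) c c′ → HasTwin c ℓ → HasTwin c′ ℓ
HasTwin-respects c≗c′ (I , J , incI , incJ , disj , same) =
  I , J , incI , incJ , disj , λ s t st → trans (sym (c≗c′ _ _)) (trans (same s t st) (c≗c′ _ _))

IsF-respects : ∀ {n r m} → (λ (c : Colouring n r) → IsF c m) Respects Pointwise (Pointwise _≡_)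
IsF-respects c≗c′ (twin , ≤m) =
  HasTwin-respects c≗c′ twin , λ ℓ twin′ → ≤m ℓ (HasTwin-respects (λ i j → sym (c≗c′ i j)) twin′)

Fr-exists : ∀ r n → ∃ (IsFr (suc r) n)
Fr-exists r n = leastValue Colouring-exhaustible IsF IsF-respects isF?
  monochromatic (proj₂ (f-exists monochromatic))
  where
  monochromatic : Colouring n (suc r)
  monochromatic _ _ = Fin.zero

indicator : ∀ {A : Set} → Dec A → Fin 2
indicator (yes _) = Fin.zero
indicator (no _) = Fin.suc Fin.zero

indicator-≡⇒⇔ : ∀ {A B : Set} (a? : Dec A) (b? : Dec B) →
                indicator a? ≡ indicator b? → (A → B) × (B → A)
indicator-≡⇒⇔ (yes a) (yes b) _ = (λ _ → b) , (λ _ → a)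
indicator-≡⇒⇔ (no ¬a) (no ¬b) _ = (λ a → contradiction a ¬a) , (λ b → contradiction b ¬b)

⇔⇒indicator-≡ : ∀ {A B : Set} (a? : Dec A) (b? : Dec B) →
                (A → B) × (B → A) → indicator a? ≡ indicator b?
⇔⇒indicator-≡ (yes a) (yes b) _ = refl
⇔⇒indicator-≡ (no ¬a) (no ¬b) _ = refl
⇔⇒indicator-≡ (yes a) (no ¬b) (a→b , _) = contradiction (a→b a) ¬b
⇔⇒indicator-≡ (no ¬a) (yes b) (_ , b→a) = contradiction (b→a b) ¬a

ascentColouring : ∀ {n} → Permutation′ n → Colouring n 2
ascentColouring π i j = indicator (π ⟨$⟩ʳ i <? π ⟨$⟩ʳ j)

ascentColouring-respects : ∀ {n} (π ρ : Permutation′ n) → π ≈ₚ ρ →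
                           Pointwise (Pointwise _≡_) (ascentColouring π) (ascentColouring ρ)
ascentColouring-respects π ρ π≈ρ i j = cong₂ (λ x y → indicator (x <? y)) (π≈ρ i) (π≈ρ j)

module _ {n : ℕ} (π : Permutation′ n) where

  weakTwin⇒twin : ∀ {ℓ} → HasWeakTwin π ℓ → HasTwin (ascentColouring π) ℓ
  weakTwin⇒twin (I , J , incI , incJ , disj , same) =
    I , J , incI , incJ , disj , λ s t st → ⇔⇒indicator-≡ _ _ (same s t st)

  twin⇒weakTwin : ∀ {ℓ} → HasTwin (ascentColouring π) ℓ → HasWeakTwin π ℓ
  twin⇒weakTwin (I , J , incI , incJ , disj , same) =
    I , J , incI , incJ , disj , λ s t st → indicator-≡⇒⇔ _ _ (same s t st)

  IsFweak⇒IsF : ∀ {m} → IsFweak π m → IsF (ascentColouring π) m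
  IsFweak⇒IsF (twin , ≤m) = weakTwin⇒twin twin , λ ℓ → ≤m ℓ ∘ twin⇒weakTwin

  IsF⇒IsFweak : ∀ {m} → IsF (ascentColouring π) m → IsFweak π m
  IsF⇒IsFweak (twin , ≤m) = twin⇒weakTwin twin , λ ℓ → ≤m ℓ ∘ weakTwin⇒twin

isFweak? : ∀ {n} (π : Permutation′ n) → Decidable (IsFweak π)
isFweak? π m = map′ (IsF⇒IsFweak π) (IsFweak⇒IsF π) (isF? (ascentColouring π) m)

IsFweak-respects : ∀ {n m} → (λ (π : Permutation′ n) → IsFweak π m) Respects _≈ₚ_
IsFweak-respects {x = π} {ρ} π≈ρ =
  IsF⇒IsFweak ρ ∘ IsF-respects (ascentColouring-respects π ρ π≈ρ) ∘ IsFweak⇒IsF π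

-- _≈ₚ_ only sees forward maps, so π and ρ must be passed to IsFweak-respects by hand.
FWeak-exists : ∀ n → ∃ (IsFWeak n)
FWeak-exists n =
  leastValue Permutation-exhaustible IsFweak (λ {_} {π} {ρ} → IsFweak-respects {x = π} {ρ}) isFweak?
    Permutation.id (IsF⇒IsFweak Permutation.id (proj₂ (f-exists (ascentColouring Permutation.id))))

proposition1 : (n : ℕ) → 1 ≤ n →
    Σ ℕ λ a → Σ ℕ λ b → IsFr 2 n a × IsFWeak n b × a ≤ b
proposition1 n _ with Fr-exists 1 n | FWeak-exists n
... | a , Fr | b , FWeak@((π , fπ) , _) =
  a , b , Fr , FWeak , proj₂ Fr (ascentColouring π) b (IsFweak⇒IsF π fπ)
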